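{- Let $G=(G_k,A_k,B_k)\circ(G_{k-1},A_{k-1},B_{k-1})\circ\cdots\circ(G_1,A_1,B_1)\circ G_0$, where each $(G_i,A_i,B_i)$, $1\le i\le k$, is a split graph with $KS$-partition $(A_i,B_i)$ and $G_0$ is a graph with at least one vertex. Then $\alpha(G)=|B_k|+|B_{k-1}|+\cdots+|B_1|+\alpha(G_0)$ and $\beta(G)=|A_k|+|A_{k-1}|+\cdots+|A_1|+\beta(G_0)$, where $\alpha$ denotes the independence number and $\beta$ the vertex cover number.
   Context: All graphs are finite and simple. A graph $G$ is split if $V(G)$ can be partitioned into sets $A$ and $B$ (either possibly empty) such that $A$ induces a clique and $B$ induces an independent set; $(A,B)$ is a $KS$-partition and $(G,A,B)$ denotes the split graph with this partition. For a split graph $(G,A,B)$ and a graph $H$ with $V(G)\cap V(H)=\emptyset$, the composition $(G,A,B)\circ H$ is the graph with vertex set $V(G)\cup V(H)$ and edge set $E(G)\cup E(H)\cup\{uv: u\in A, v\in V(H)\}$; if $H$ is a split graph $(H,A',B')$, the composition is regarded as the split graph with $KS$-partition $(A\cup A',B\cup B')$. Composition is associative, and the iterated expression $(G_k,A_k,B_k)\circ\cdots\circ(G_1,A_1,B_1)\circ G_0$ is well defined. The decomposition need not be the canonical one. -}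

module Defs where

open import Data.Nat using (ℕ; zero; suc; _+_; _≤_)
open import Data.Fin using (Fin; splitAt)
open import Data.Fin.Subset using (Subset; _∈_; _∉_; ∁; ∣_∣)
open import Data.Sum using (_⊎_; inj₁; inj₂)
open import Data.Product using (Σ; _×_; _,_)
open import Data.List using (List; []; _∷_)
open import Relation.Nullary using (¬_)
open import Relation.Binary.PropositionalEquality using (_≡_; _≢_)

record Graph : Set₁ where
  field
    n      : ℕ
    Adj    : Fin n → Fin n → Set
    sym    : ∀ {u v} → Adj u v → Adj v u
    irrefl : ∀ {v} → ¬ Adj v v
open Graph public

record SplitGraph : Set₁ where
  field
    graph  : Graph
    A      : Subset (n graph)
    clique : ∀ u v → u ∈ A → v ∈ A → u ≢ v → Adj graph u v
    indep  : ∀ u v → u ∉ A → v ∉ A → ¬ Adj graph u v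
  B : Subset (n graph)
  B = ∁ A
open SplitGraph public

compAdj⊎ : (S : SplitGraph) (H : Graph) →
           Fin (n (graph S)) ⊎ Fin (n H) → Fin (n (graph S)) ⊎ Fin (n H) → Set
compAdj⊎ S H (inj₁ u) (inj₁ v) = Adj (graph S) u v
compAdj⊎ S H (inj₂ u) (inj₂ v) = Adj H u v
compAdj⊎ S H (inj₁ u) (inj₂ v) = u ∈ A S
compAdj⊎ S H (inj₂ u) (inj₁ v) = v ∈ A S

compAdj⊎-sym : ∀ S H x y → compAdj⊎ S H x y → compAdj⊎ S H y x
compAdj⊎-sym S H (inj₁ u) (inj₁ v) e = sym (graph S) e
compAdj⊎-sym S H (inj₂ u) (inj₂ v) e = sym H e
compAdj⊎-sym S H (inj₁ u) (inj₂ v) e = e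
compAdj⊎-sym S H (inj₂ u) (inj₁ v) e = e

compAdj⊎-irrefl : ∀ S H x → ¬ compAdj⊎ S H x x
compAdj⊎-irrefl S H (inj₁ u) = irrefl (graph S)
compAdj⊎-irrefl S H (inj₂ u) = irrefl H

-- The composition (G, A, B) ∘ H : vertices of G are Fin n, those of H are
-- shifted to n, ..., n+m-1; edges E(G) ∪ E(H) ∪ {uv : u ∈ A, v ∈ V(H)}.
_∘G_ : SplitGraph → Graph → Graph
S ∘G H = record
  { n      = n (graph S) + n H
  ; Adj    = λ x y → compAdj⊎ S H (splitAt (n (graph S)) x) (splitAt (n (graph S)) y)
  ; sym    = λ {x} {y} → compAdj⊎-sym S H (splitAt (n (graph S)) x) (splitAt (n (graph S)) y)
  ; irrefl = λ {x} → compAdj⊎-irrefl S H (splitAt (n (graph S)) x)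
  }

-- composeAll (G_k ∷ ... ∷ G_1 ∷ []) G₀ = G_k ∘ (G_{k-1} ∘ ( ... ∘ (G_1 ∘ G₀)))
composeAll : List SplitGraph → Graph → Graph
composeAll []       H = H
composeAll (S ∷ Ss) H = S ∘G composeAll Ss H

sumA : List SplitGraph → ℕ
sumA []       = 0
sumA (S ∷ Ss) = ∣ A S ∣ + sumA Ss

sumB : List SplitGraph → ℕ
sumB []       = 0
sumB (S ∷ Ss) = ∣ B S ∣ + sumB Ss

Independent : (G : Graph) → Subset (n G) → Set
Independent G S = ∀ u v → u ∈ S → v ∈ S → ¬ Adj G u v

VertexCover : (G : Graph) → Subset (n G) → Set
VertexCover G S = ∀ u v → Adj G u v → u ∈ S ⊎ v ∈ S

IsIndependenceNumber : Graph → ℕ → Set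
IsIndependenceNumber G a =
  Σ (Subset (n G)) (λ S → Independent G S × ∣ S ∣ ≡ a) ×
  (∀ S → Independent G S → ∣ S ∣ ≤ a)

IsVertexCoverNumber : Graph → ℕ → Set
IsVertexCoverNumber G b =
  Σ (Subset (n G)) (λ S → VertexCover G S × ∣ S ∣ ≡ b) ×
  (∀ S → VertexCover G S → b ≤ ∣ S ∣)

{-# OPTIONS --safe #-}
-- An independent set of (G, A, B) ∘ H meets the clique A in at most one vertex u, and u
-- is adjacent to all of H.  So either it lies inside {u} ∪ B, or it lies in B ∪ V(H) and
-- meets H in an independent set of H; since α(H) ≥ 1 both have size ≤ |B| + α(H), which
-- B together with a maximum independent set of H attains.  Induction gives α of the
-- iterated composition, and Gallai's identity α + β = |V| turns this into β.
module Submission where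

open import Defs hiding (sym)
open import Algebra.Properties.CommutativeSemigroup using (interchange)
open import Data.Bool using (true; false)
open import Data.Fin using (Fin; splitAt; join; fromℕ<; _≟_)
open import Data.Fin.Properties using (splitAt-join)
open import Data.Fin.Subset using (Subset; _∈_; ∁; ∣_∣; ⁅_⁆; _∪_; _∩_; _⊆_; Empty)
open import Data.Fin.Subset.Properties
  using (_∈?_; nonempty?; Empty-unique; ∣p∣≤n; ∣⊥∣≡0; ∣∁p∣≡n∸∣p∣; ∣⁅x⁆∣≡1; p⊆q⇒∣p∣≤∣q∣; x∈⁅x⁆; x∈⁅y⁆⇒x≡y;
         x∈∁p⇒x∉p; x∉p⇒x∈∁p; x∈p∩q⁺; x∈p∩q⁻; x∈p∪q⁺)
open import Data.List using (List; []; _∷_)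
open import Data.Nat using (ℕ; suc; _+_; _≤_; z≤n; s≤s)
open import Data.Nat.Properties
  using (≤-trans; ≤-antisym; n≤1+n; m≤n+m; +-comm; +-assoc; +-suc; +-identityʳ; m+[n∸m]≡n;
         +-mono-≤; +-monoʳ-≤; +-cancelˡ-≡; +-cancelˡ-≤; +-commutativeSemigroup; module ≤-Reasoning)
open import Data.Product using (_×_; _,_; proj₁; proj₂)
open import Data.Sum using (inj₁; inj₂; [_,_]′)
open import Data.Vec using ([]; _∷_; _++_; lookup)
import Data.Vec as Vec
open import Data.Vec.Properties using (lookup-splitAt; []=⇒lookup; lookup⇒[]=)
open import Relation.Nullary using (¬_; yes; no; contradiction)
open import Relation.Binary.PropositionalEquality
  using (_≡_; refl; sym; trans; cong; cong₂; subst; subst₂; module ≡-Reasoning)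

private
  variable
    k l : ℕ

∈-++⁻ : (X : Subset k) (Y : Subset l) (x : Fin (k + l)) →
        x ∈ X ++ Y → [ _∈ X , _∈ Y ]′ (splitAt k x)
∈-++⁻ {k} X Y x x∈ = from-lookup (splitAt k x) (trans (sym (lookup-splitAt k X Y x)) ([]=⇒lookup x∈))
  where
  from-lookup : ∀ s → [ lookup X , lookup Y ]′ s ≡ true → [ _∈ X , _∈ Y ]′ s
  from-lookup (inj₁ i) eq = lookup⇒[]= i X eq
  from-lookup (inj₂ j) eq = lookup⇒[]= j Y eq

∈-++⁺ : (X : Subset k) (Y : Subset l) (x : Fin (k + l)) →
        [ _∈ X , _∈ Y ]′ (splitAt k x) → x ∈ X ++ Y
∈-++⁺ {k} X Y x x∈ = lookup⇒[]= x (X ++ Y) (trans (lookup-splitAt k X Y x) (to-lookup (splitAt k x) x∈))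
  where
  to-lookup : ∀ s → [ _∈ X , _∈ Y ]′ s → [ lookup X , lookup Y ]′ s ≡ true
  to-lookup (inj₁ i) i∈ = []=⇒lookup i∈
  to-lookup (inj₂ j) j∈ = []=⇒lookup j∈

∣p++q∣≡∣p∣+∣q∣ : (X : Subset k) (Y : Subset l) → ∣ X ++ Y ∣ ≡ ∣ X ∣ + ∣ Y ∣
∣p++q∣≡∣p∣+∣q∣ []          Y = refl
∣p++q∣≡∣p∣+∣q∣ (true ∷ X)  Y = cong suc (∣p++q∣≡∣p∣+∣q∣ X Y)
∣p++q∣≡∣p∣+∣q∣ (false ∷ X) Y = ∣p++q∣≡∣p∣+∣q∣ X Y

∣p∪q∣≤∣p∣+∣q∣ : (X Y : Subset k) → ∣ X ∪ Y ∣ ≤ ∣ X ∣ + ∣ Y ∣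
∣p∪q∣≤∣p∣+∣q∣ []          []          = z≤n
∣p∪q∣≤∣p∣+∣q∣ (true ∷ X)  (true ∷ Y)  = s≤s (≤-trans (∣p∪q∣≤∣p∣+∣q∣ X Y) (+-monoʳ-≤ ∣ X ∣ (n≤1+n ∣ Y ∣)))
∣p∪q∣≤∣p∣+∣q∣ (true ∷ X)  (false ∷ Y) = s≤s (∣p∪q∣≤∣p∣+∣q∣ X Y)
∣p∪q∣≤∣p∣+∣q∣ (false ∷ X) (true ∷ Y)  = subst (suc ∣ X ∪ Y ∣ ≤_) (sym (+-suc ∣ X ∣ ∣ Y ∣)) (s≤s (∣p∪q∣≤∣p∣+∣q∣ X Y))
∣p∪q∣≤∣p∣+∣q∣ (false ∷ X) (false ∷ Y) = ∣p∪q∣≤∣p∣+∣q∣ X Y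

∣p∣+∣∁p∣≡n : (X : Subset k) → ∣ X ∣ + ∣ ∁ X ∣ ≡ k
∣p∣+∣∁p∣≡n X = trans (cong (∣ X ∣ +_) (∣∁p∣≡n∸∣p∣ X)) (m+[n∸m]≡n (∣p∣≤n X))

+-interchange : ∀ w x y z → (w + x) + (y + z) ≡ (w + y) + (x + z)
+-interchange = interchange +-commutativeSemigroup

Empty[p∩q]⇒p⊆∁q : {X Y : Subset k} → Empty (X ∩ Y) → X ⊆ ∁ Y
Empty[p∩q]⇒p⊆∁q X∩Y-empty {x} x∈X = x∉p⇒x∈∁p λ x∈Y → X∩Y-empty (x , x∈p∩q⁺ (x∈X , x∈Y))

module _ (G : Graph) where

  ⁅x⁆-independent : (x : Fin (n G)) → Independent G ⁅ x ⁆
  ⁅x⁆-independent x u v u∈⁅x⁆ v∈⁅x⁆ u~v =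
    irrefl G (subst₂ (Adj G) (x∈⁅y⁆⇒x≡y x u∈⁅x⁆) (x∈⁅y⁆⇒x≡y x v∈⁅x⁆) u~v)

  independenceNumber-positive : ∀ {a} → 1 ≤ n G → IsIndependenceNumber G a → 1 ≤ a
  independenceNumber-positive 0<n (_ , maximal) =
    subst (_≤ _) (∣⁅x⁆∣≡1 v) (maximal ⁅ v ⁆ (⁅x⁆-independent v))
    where
    v : Fin (n G)
    v = fromℕ< 0<n

  independent⇒∁-vertexCover : ∀ {I} → Independent G I → VertexCover G (∁ I)
  independent⇒∁-vertexCover {I} I-ind u v u~v with u ∈? I | v ∈? I
  ... | yes u∈I | yes v∈I = contradiction u~v (I-ind u v u∈I v∈I)
  ... | no u∉I  | _       = inj₁ (x∉p⇒x∈∁p u∉I)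
  ... | yes _   | no v∉I  = inj₂ (x∉p⇒x∈∁p v∉I)

  vertexCover⇒∁-independent : ∀ {C} → VertexCover G C → Independent G (∁ C)
  vertexCover⇒∁-independent C-cover u v u∈∁C v∈∁C u~v with C-cover u v u~v
  ... | inj₁ u∈C = x∈∁p⇒x∉p u∈∁C u∈C
  ... | inj₂ v∈C = x∈∁p⇒x∉p v∈∁C v∈C

  vertexCoverNumber-unique : ∀ {b c} → IsVertexCoverNumber G b → IsVertexCoverNumber G c → b ≡ c
  vertexCoverNumber-unique ((C , C-cover , ∣C∣≡b) , b-min) ((D , D-cover , ∣D∣≡c) , c-min) =
    ≤-antisym (subst (_ ≤_) ∣D∣≡c (b-min D D-cover)) (subst (_ ≤_) ∣C∣≡b (c-min C C-cover))

  complement-isVertexCoverNumber : ∀ {a b} → IsIndependenceNumber G a → a + b ≡ n G →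
                                   IsVertexCoverNumber G b
  complement-isVertexCoverNumber {a} {b} ((I , I-ind , ∣I∣≡a) , maximal) a+b≡n =
    (∁ I , independent⇒∁-vertexCover I-ind , ∣∁I∣≡b) , minimal
    where
    ∣∁I∣≡b : ∣ ∁ I ∣ ≡ b
    ∣∁I∣≡b = +-cancelˡ-≡ a _ _ (begin
      a + ∣ ∁ I ∣     ≡⟨ cong (_+ ∣ ∁ I ∣) (sym ∣I∣≡a) ⟩
      ∣ I ∣ + ∣ ∁ I ∣ ≡⟨ ∣p∣+∣∁p∣≡n I ⟩
      n G             ≡⟨ sym a+b≡n ⟩
      a + b           ∎)
      where open ≡-Reasoning
    minimal : ∀ C → VertexCover G C → b ≤ ∣ C ∣
    minimal C C-cover = +-cancelˡ-≤ a _ _ (begin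
      a + b           ≡⟨ a+b≡n ⟩
      n G             ≡⟨ sym (∣p∣+∣∁p∣≡n C) ⟩
      ∣ C ∣ + ∣ ∁ C ∣ ≤⟨ +-monoʳ-≤ ∣ C ∣ (maximal (∁ C) (vertexCover⇒∁-independent C-cover)) ⟩
      ∣ C ∣ + a       ≡⟨ +-comm ∣ C ∣ a ⟩
      a + ∣ C ∣       ∎)
      where open ≤-Reasoning

  gallai : ∀ {a b} → IsIndependenceNumber G a → IsVertexCoverNumber G b → a + b ≡ n G
  gallai {a} {b} α@((I , _ , ∣I∣≡a) , _) β = begin
    a + b           ≡⟨ cong (a +_) (vertexCoverNumber-unique β (complement-isVertexCoverNumber α a+∣∁I∣≡n)) ⟩
    a + ∣ ∁ I ∣     ≡⟨ a+∣∁I∣≡n ⟩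
    n G             ∎
    where
    open ≡-Reasoning
    a+∣∁I∣≡n : a + ∣ ∁ I ∣ ≡ n G
    a+∣∁I∣≡n = trans (cong (_+ ∣ ∁ I ∣) (sym ∣I∣≡a)) (∣p∣+∣∁p∣≡n I)

independent⊆⁅x⁆∪B : (S : SplitGraph) {X : Subset (n (graph S))} {x : Fin (n (graph S))} →
                    Independent (graph S) X → x ∈ X → x ∈ A S → X ⊆ ⁅ x ⁆ ∪ B S
independent⊆⁅x⁆∪B S {x = x} X-ind x∈X x∈A {y} y∈X with y ∈? A S
... | no y∉A = x∈p∪q⁺ (inj₂ (x∉p⇒x∈∁p y∉A))
... | yes y∈A with y ≟ x
...   | yes refl = x∈p∪q⁺ (inj₁ (x∈⁅x⁆ y))
...   | no y≢x   = contradiction (clique S y x y∈A x∈A y≢x) (X-ind y x y∈X x∈X)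

module _ (S : SplitGraph) (H : Graph) where
  private
    p₁ = n (graph S)
    p₂ = n H

  -- Independence of X ++ Y in S ∘G H, stated on V(G) ⊎ V(H) where compAdj⊎ computes.
  Independent⊎ : Subset p₁ → Subset p₂ → Set
  Independent⊎ X Y = ∀ x y → [ _∈ X , _∈ Y ]′ x → [ _∈ X , _∈ Y ]′ y → ¬ compAdj⊎ S H x y

  independent⊎⇒independent : ∀ {X Y} → Independent⊎ X Y → Independent (S ∘G H) (X ++ Y)
  independent⊎⇒independent {X} {Y} ind u v u∈ v∈ =
    ind (splitAt p₁ u) (splitAt p₁ v) (∈-++⁻ X Y u u∈) (∈-++⁻ X Y v v∈)

  independent⇒independent⊎ : ∀ {X Y} → Independent (S ∘G H) (X ++ Y) → Independent⊎ X Y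
  independent⇒independent⊎ {X} {Y} ind x y x∈ y∈ x~y =
    ind (join p₁ p₂ x) (join p₁ p₂ y)
      (∈-++⁺ X Y _ (subst [ _∈ X , _∈ Y ]′ (sym (splitAt-join p₁ p₂ x)) x∈))
      (∈-++⁺ X Y _ (subst [ _∈ X , _∈ Y ]′ (sym (splitAt-join p₁ p₂ y)) y∈))
      (subst₂ (compAdj⊎ S H) (sym (splitAt-join p₁ p₂ x)) (sym (splitAt-join p₁ p₂ y)) x~y)

  B⊎-independent : ∀ {I} → Independent H I → Independent⊎ (B S) I
  B⊎-independent I-ind (inj₁ u) (inj₁ v) u∈B v∈B = indep S u v (x∈∁p⇒x∉p u∈B) (x∈∁p⇒x∉p v∈B)
  B⊎-independent I-ind (inj₁ u) (inj₂ v) u∈B _   = x∈∁p⇒x∉p u∈B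
  B⊎-independent I-ind (inj₂ u) (inj₁ v) _   v∈B = x∈∁p⇒x∉p v∈B
  B⊎-independent I-ind (inj₂ u) (inj₂ v) u∈I v∈I = I-ind u v u∈I v∈I

  independent⊎-bound : ∀ {a} → IsIndependenceNumber H a → 1 ≤ a →
                       ∀ X Y → Independent⊎ X Y → ∣ X ∣ + ∣ Y ∣ ≤ ∣ B S ∣ + a
  independent⊎-bound {a} (_ , maximal) 1≤a X Y ind with nonempty? (X ∩ A S)
  ... | no X∩A-empty =
    +-mono-≤ (p⊆q⇒∣p∣≤∣q∣ (Empty[p∩q]⇒p⊆∁q X∩A-empty)) (maximal Y λ u v → ind (inj₂ u) (inj₂ v))
  ... | yes (u , u∈X∩A) = begin
    ∣ X ∣ + ∣ Y ∣         ≡⟨ cong (∣ X ∣ +_) ∣Y∣≡0 ⟩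
    ∣ X ∣ + 0             ≡⟨ +-identityʳ ∣ X ∣ ⟩
    ∣ X ∣                 ≤⟨ p⊆q⇒∣p∣≤∣q∣ (independent⊆⁅x⁆∪B S (λ u v → ind (inj₁ u) (inj₁ v)) u∈X u∈A) ⟩
    ∣ ⁅ u ⁆ ∪ B S ∣       ≤⟨ ∣p∪q∣≤∣p∣+∣q∣ ⁅ u ⁆ (B S) ⟩
    ∣ ⁅ u ⁆ ∣ + ∣ B S ∣   ≡⟨ cong (_+ ∣ B S ∣) (∣⁅x⁆∣≡1 u) ⟩
    1 + ∣ B S ∣           ≡⟨ +-comm 1 ∣ B S ∣ ⟩
    ∣ B S ∣ + 1           ≤⟨ +-monoʳ-≤ ∣ B S ∣ 1≤a ⟩
    ∣ B S ∣ + a           ∎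
    where
    open ≤-Reasoning
    u∈X : u ∈ X
    u∈X = proj₁ (x∈p∩q⁻ X (A S) u∈X∩A)
    u∈A : u ∈ A S
    u∈A = proj₂ (x∈p∩q⁻ X (A S) u∈X∩A)
    -- u ∈ A is adjacent to every vertex of H.
    ∣Y∣≡0 : ∣ Y ∣ ≡ 0
    ∣Y∣≡0 = trans (cong ∣_∣ (Empty-unique λ (v , v∈Y) → ind (inj₁ u) (inj₂ v) u∈X v∈Y u∈A)) (∣⊥∣≡0 p₂)

  independenceNumber-∘G : ∀ {a} → 1 ≤ a → IsIndependenceNumber H a →
                          IsIndependenceNumber (S ∘G H) (∣ B S ∣ + a)
  independenceNumber-∘G {a} 1≤a αH@((I , I-ind , ∣I∣≡a) , _) =
    (B S ++ I , independent⊎⇒independent (B⊎-independent I-ind) , ∣B++I∣≡∣B∣+a) , maximal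
    where
    ∣B++I∣≡∣B∣+a : ∣ B S ++ I ∣ ≡ ∣ B S ∣ + a
    ∣B++I∣≡∣B∣+a = trans (∣p++q∣≡∣p∣+∣q∣ (B S) I) (cong (∣ B S ∣ +_) ∣I∣≡a)
    maximal : ∀ Z → Independent (S ∘G H) Z → ∣ Z ∣ ≤ ∣ B S ∣ + a
    maximal Z with Vec.splitAt p₁ Z
    ... | X , Y , refl = λ ind →
      subst (_≤ ∣ B S ∣ + a) (sym (∣p++q∣≡∣p∣+∣q∣ X Y))
        (independent⊎-bound αH 1≤a X Y (independent⇒independent⊎ ind))

independenceNumber-composeAll : ∀ Ss G₀ {a} → 1 ≤ a → IsIndependenceNumber G₀ a →
                                IsIndependenceNumber (composeAll Ss G₀) (sumB Ss + a)
independenceNumber-composeAll []       G₀ 1≤a α = α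
independenceNumber-composeAll (S ∷ Ss) G₀ {a} 1≤a α =
  subst (IsIndependenceNumber (composeAll (S ∷ Ss) G₀)) (sym (+-assoc ∣ B S ∣ (sumB Ss) a))
    (independenceNumber-∘G S (composeAll Ss G₀) (≤-trans 1≤a (m≤n+m a (sumB Ss)))
      (independenceNumber-composeAll Ss G₀ 1≤a α))

n-composeAll : ∀ Ss G₀ → n (composeAll Ss G₀) ≡ (sumB Ss + sumA Ss) + n G₀
n-composeAll []       G₀ = refl
n-composeAll (S ∷ Ss) G₀ = begin
  n (graph S) + n (composeAll Ss G₀)                         ≡⟨ cong₂ _+_ n≡∣B∣+∣A∣ (n-composeAll Ss G₀) ⟩
  (∣ B S ∣ + ∣ A S ∣) + ((sumB Ss + sumA Ss) + n G₀)         ≡⟨ sym (+-assoc (∣ B S ∣ + ∣ A S ∣) _ _) ⟩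
  ((∣ B S ∣ + ∣ A S ∣) + (sumB Ss + sumA Ss)) + n G₀         ≡⟨ cong (_+ n G₀) (+-interchange ∣ B S ∣ ∣ A S ∣ (sumB Ss) (sumA Ss)) ⟩
  ((∣ B S ∣ + sumB Ss) + (∣ A S ∣ + sumA Ss)) + n G₀         ∎
  where
  open ≡-Reasoning
  n≡∣B∣+∣A∣ : n (graph S) ≡ ∣ B S ∣ + ∣ A S ∣
  n≡∣B∣+∣A∣ = trans (sym (∣p∣+∣∁p∣≡n (A S))) (+-comm ∣ A S ∣ ∣ B S ∣)

mainTheorem2 : (Ss : List SplitGraph) (G₀ : Graph) → 1 ≤ n G₀ →
    (a b : ℕ) → IsIndependenceNumber G₀ a → IsVertexCoverNumber G₀ b →
    IsIndependenceNumber (composeAll Ss G₀) (sumB Ss + a) ×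
    IsVertexCoverNumber (composeAll Ss G₀) (sumA Ss + b)
mainTheorem2 Ss G₀ 0<n a b α β =
  α-composite , complement-isVertexCoverNumber (composeAll Ss G₀) α-composite α+β≡n
  where
  open ≡-Reasoning
  α-composite : IsIndependenceNumber (composeAll Ss G₀) (sumB Ss + a)
  α-composite = independenceNumber-composeAll Ss G₀ (independenceNumber-positive G₀ 0<n α) α
  α+β≡n : (sumB Ss + a) + (sumA Ss + b) ≡ n (composeAll Ss G₀)
  α+β≡n = begin
    (sumB Ss + a) + (sumA Ss + b) ≡⟨ +-interchange (sumB Ss) a (sumA Ss) b ⟩
    (sumB Ss + sumA Ss) + (a + b) ≡⟨ cong (sumB Ss + sumA Ss +_) (gallai G₀ α β) ⟩
    (sumB Ss + sumA Ss) + n G₀    ≡⟨ sym (n-composeAll Ss G₀) ⟩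
    n (composeAll Ss G₀)          ∎
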